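{- Let $P$ be a poset such that $A'=\operatorname{cl}_\sigma(A)$ for every subset $A\subseteq P$ (i.e. $P$ has one-step closure). Then $P$ is meet-continuous: for any $x\in P$ and any directed subset $D\subseteq P$ such that $\bigvee D$ exists and $x\le\bigvee D$, one has $x\in\operatorname{cl}_\sigma(\mathord{\downarrow}D\cap\mathord{\downarrow}x)$.
   Context: $\mathord{\downarrow}X=\{z\mid \exists y\in X,\ z\le y\}$, $\mathord{\downarrow}x=\mathord{\downarrow}\{x\}$. A subset is directed if nonempty and every finite subset has an upper bound in it. For $A\subseteq P$, $A'=\{x\in P\mid x=\bigvee D \text{ for some directed } D\subseteq\mathord{\downarrow}A\}$. A set $U$ is Scott open if it is an upper set and whenever $D$ is directed with $\bigvee D$ existing and in $U$, then $D\cap U\ne\emptyset$; $\operatorname{cl}_\sigma$ is closure in the Scott topology. -}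

module Defs where

open import Level using (Level; _⊔_; suc)
open import Relation.Binary.Bundles using (Poset)
open import Relation.Unary using (Pred; _∈_; _∩_; _⊆_; Satisfiable)
open import Data.Product using (Σ; ∃; _×_; _,_)

-- Order-theoretic notions on a poset P. Subsets of P are predicates at
-- level  c ⊔ ℓ₂ ⊔ ℓ  (closed under ↓ and ∩).
module PosetDefs {c ℓ₁ ℓ₂ : Level} (P : Poset c ℓ₁ ℓ₂) (ℓ : Level) where
  open Poset P

  L : Level
  L = c ⊔ ℓ₂ ⊔ ℓ

  Subset : Set (c ⊔ suc L)
  Subset = Pred Carrier L

  ↓ : Subset → Subset
  ↓ X z = Σ Carrier (λ y → y ∈ X × z ≤ y)

  ↓pt : Carrier → Subset
  ↓pt x z = Level.Lift L (z ≤ x)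

  Directed : Subset → Set (c ⊔ ℓ₂ ⊔ L)
  Directed D = Satisfiable D ×
               (∀ {a b} → a ∈ D → b ∈ D → Σ Carrier (λ u → u ∈ D × a ≤ u × b ≤ u))

  IsSup : Subset → Carrier → Set (c ⊔ ℓ₂ ⊔ L)
  IsSup D s = (∀ {d} → d ∈ D → d ≤ s) ×
              (∀ u → (∀ {d} → d ∈ D → d ≤ u) → s ≤ u)

  _′ : Subset → Pred Carrier (c ⊔ ℓ₂ ⊔ suc L)
  (A ′) x = Σ Subset (λ D → Directed D × D ⊆ ↓ A × IsSup D x)

  UpperSet : Subset → Set (c ⊔ ℓ₂ ⊔ L)
  UpperSet U = ∀ {x y} → x ≤ y → x ∈ U → y ∈ U

  ScottOpen : Subset → Set (c ⊔ ℓ₂ ⊔ suc L)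
  ScottOpen U = UpperSet U ×
    (∀ (D : Subset) (s : Carrier) → Directed D → IsSup D s → s ∈ U →
       Satisfiable (D ∩ U))

  clσ : Subset → Pred Carrier (c ⊔ ℓ₂ ⊔ suc L)
  clσ A x = ∀ (U : Subset) → ScottOpen U → x ∈ U → Satisfiable (A ∩ U)

  OneStepClosure : Set (c ⊔ ℓ₂ ⊔ suc L)
  OneStepClosure = ∀ (A : Subset) → (A ′ ⊆ clσ A) × (clσ A ⊆ A ′)

  MeetContinuous : Set (c ⊔ ℓ₂ ⊔ suc L)
  MeetContinuous = ∀ (x : Carrier) (D : Subset) (s : Carrier) →
    Directed D → IsSup D s → x ≤ s → x ∈ clσ (↓ D ∩ ↓pt x)

module Submission where

-- Any Scott open set containing x contains ⋁D ≥ x, hence meets D; so x ∈ cl_σ(D),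
-- and one-step closure writes x = ⋁E with E ⊆ ↓D directed. Every element of E lies
-- below x, so E ⊆ ↓(↓D ∩ ↓x), i.e. x ∈ (↓D ∩ ↓x)′ = cl_σ(↓D ∩ ↓x).

open import Defs
open import Level using (Level; lift)
open import Relation.Binary.Bundles using (Poset)
open import Relation.Unary using (_∩_)
open import Data.Product using (_,_; proj₁; proj₂)

module _ {c ℓ₁ ℓ₂ : Level} (P : Poset c ℓ₁ ℓ₂) (ℓ : Level) where
  open Poset P
  open PosetDefs P ℓ

  ≤sup⇒∈clσ : ∀ {D s x} → Directed D → IsSup D s → x ≤ s → clσ D x
  ≤sup⇒∈clσ {D} {s} dirD supD x≤s U (upU , inaccessibleU) x∈U =
    inaccessibleU D s dirD supD (upU x≤s x∈U)

  ∈′⇒∈′-↓∩↓pt : ∀ {A x} → (A ′) x → ((↓ A ∩ ↓pt x) ′) x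
  ∈′⇒∈′-↓∩↓pt {A} {x} (E , dirE , E⊆↓A , supE@(ub , _)) =
    E , dirE , E⊆↓[↓A∩↓x] , supE
    where
      E⊆↓[↓A∩↓x] : ∀ {e} → E e → ↓ (↓ A ∩ ↓pt x) e
      E⊆↓[↓A∩↓x] e∈E = _ , (E⊆↓A e∈E , lift (ub e∈E)) , refl

theorem5p8 : {c ℓ₁ ℓ₂ : Level} (P : Poset c ℓ₁ ℓ₂) (ℓ : Level) →
    PosetDefs.OneStepClosure P ℓ → PosetDefs.MeetContinuous P ℓ
theorem5p8 P ℓ oneStep x D s dirD supD x≤s =
  proj₁ (oneStep (↓ D ∩ ↓pt x))
    (∈′⇒∈′-↓∩↓pt P ℓ (proj₂ (oneStep D) (≤sup⇒∈clσ P ℓ dirD supD x≤s)))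
  where open PosetDefs P ℓ
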